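{- (1) Let $D$ be a digraph and $\ell\in\mathbb{N}$. Then there exists a complete acyclic coloring of $D$ using exactly $\ell$ colors if and only if $\vec\chi(D)\le\ell\le{\rm adi}(D)$. (2) Let $G$ be a graph and $\ell\in\mathbb{N}$. Then there exists a complete arboreal coloring of $G$ using exactly $\ell$ colors if and only if ${\rm va}(G)\le\ell\le{\rm ava}(G)$.
   Context: Graphs are finite, loopless and may have multiple edges (a bigon counts as a cycle); digraphs are finite, loopless and may have parallel and anti-parallel arcs (a digon counts as a directed cycle). The dichromatic number $\vec\chi(D)$ is the minimum number of colors in a partition of $V(D)$ into sets each inducing an acyclic subdigraph; the vertex arboricity ${\rm va}(G)$ is the minimum number of colors in a partition of $V(G)$ into sets each inducing a forest. A \emph{complete acyclic coloring} of $D$ is a partition of $V(D)$ into color classes each inducing an acyclic subdigraph such that the union of any two distinct color classes induces a subdigraph containing a directed cycle; ${\rm adi}(D)$ is the maximum number of colors in such a coloring. A \emph{complete arboreal coloring} of $G$ is a partition of $V(G)$ into color classes each inducing a forest such that the union of any two distinct color classes induces a subgraph containing a cycle; ${\rm ava}(G)$ is the maximum number of colors in such a coloring. -}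

module Defs where

open import Data.Nat using (ℕ; _≤_; _<_)
open import Data.Fin using (Fin)
open import Data.List using (List; []; _∷_; _++_; length)
open import Data.List.Relation.Unary.All using (All)
open import Data.List.Relation.Unary.Unique.Propositional using (Unique)
open import Data.Product using (Σ; ∃; ∃-syntax; _×_)
open import Data.Sum using (_⊎_)
open import Relation.Nullary using (¬_)
open import Relation.Binary.PropositionalEquality using (_≡_; _≢_)

data Chain {A : Set} (R : A → A → Set) : List A → Set where
  []  : Chain R []
  [-] : ∀ {x} → Chain R (x ∷ [])
  _∷_ : ∀ {x y xs} → R x y → Chain R (y ∷ xs) → Chain R (x ∷ y ∷ xs)

Subset : ℕ → Set₁
Subset n = Fin n → Set

TwoClasses : ∀ {n k} → (Fin n → Fin k) → Fin k → Fin k → Subset n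
TwoClasses c i j v = (c v ≡ i) ⊎ (c v ≡ j)

ColourClass : ∀ {n k} → (Fin n → Fin k) → Fin k → Subset n
ColourClass c i v = c v ≡ i

-- a partition of V into exactly k (nonempty) colour classes
IsOnto : ∀ {n k} → (Fin n → Fin k) → Set
IsOnto {n} {k} c = (i : Fin k) → ∃[ v ] c v ≡ i

-- Digraphs: vertex set Fin n, arc multiplicities, loopless
-- (parallel and anti-parallel arcs allowed)

record Digraph (n : ℕ) : Set where
  field
    arcs     : Fin n → Fin n → ℕ
    loopless : ∀ v → arcs v v ≡ 0

open Digraph public

Arc : ∀ {n} → Digraph n → Fin n → Fin n → Set
Arc D u v = 1 ≤ arcs D u v

HasDirCycle : ∀ {n} → Digraph n → Subset n → Set
HasDirCycle {n} D S =
  Σ (Fin n) λ v → Σ (List (Fin n)) λ ws →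
    Unique (v ∷ ws) × All S (v ∷ ws) × Chain (Arc D) (v ∷ ws ++ v ∷ [])

Acyclic : ∀ {n} → Digraph n → Subset n → Set
Acyclic D S = ¬ HasDirCycle D S

IsAcyclicColoring : ∀ {n k} → Digraph n → (Fin n → Fin k) → Set
IsAcyclicColoring {k = k} D c = IsOnto c × ((i : Fin k) → Acyclic D (ColourClass c i))

IsCompleteAcyclicColoring : ∀ {n k} → Digraph n → (Fin n → Fin k) → Set
IsCompleteAcyclicColoring {k = k} D c =
  IsAcyclicColoring D c ×
  ((i j : Fin k) → i ≢ j → HasDirCycle D (TwoClasses c i j))

HasAcyclicColoring : ∀ {n} → Digraph n → ℕ → Set
HasAcyclicColoring {n} D k = Σ (Fin n → Fin k) (IsAcyclicColoring D)

HasCompleteAcyclicColoring : ∀ {n} → Digraph n → ℕ → Set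
HasCompleteAcyclicColoring {n} D k = Σ (Fin n → Fin k) (IsCompleteAcyclicColoring D)

IsDichromaticNumber : ∀ {n} → Digraph n → ℕ → Set
IsDichromaticNumber D k = HasAcyclicColoring D k × (∀ m → HasAcyclicColoring D m → k ≤ m)

IsAdi : ∀ {n} → Digraph n → ℕ → Set
IsAdi D a = HasCompleteAcyclicColoring D a × (∀ m → HasCompleteAcyclicColoring D m → m ≤ a)

-- Graphs: vertex set Fin n, symmetric edge multiplicities, loopless

record Graph (n : ℕ) : Set where
  field
    edges     : Fin n → Fin n → ℕ
    loopless  : ∀ v → edges v v ≡ 0
    symmetric : ∀ u v → edges u v ≡ edges v u

open Graph public

Adj : ∀ {n} → Graph n → Fin n → Fin n → Set
Adj G u v = 1 ≤ edges G u v

-- a cycle in the subgraph induced by S: either a bigon (two parallel edges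
-- between vertices of S) or distinct vertices v ∷ ws (at least 3) in S,
-- cyclically consecutive ones adjacent
HasCycle : ∀ {n} → Graph n → Subset n → Set
HasCycle {n} G S =
  (Σ (Fin n) λ u → Σ (Fin n) λ v → S u × S v × 2 ≤ edges G u v)
  ⊎
  (Σ (Fin n) λ v → Σ (List (Fin n)) λ ws →
     3 ≤ length (v ∷ ws) × Unique (v ∷ ws) × All S (v ∷ ws) ×
     Chain (Adj G) (v ∷ ws ++ v ∷ []))

Forest : ∀ {n} → Graph n → Subset n → Set
Forest G S = ¬ HasCycle G S

IsArborealColoring : ∀ {n k} → Graph n → (Fin n → Fin k) → Set
IsArborealColoring {k = k} G c = IsOnto c × ((i : Fin k) → Forest G (ColourClass c i))

IsCompleteArborealColoring : ∀ {n k} → Graph n → (Fin n → Fin k) → Set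
IsCompleteArborealColoring {k = k} G c =
  IsArborealColoring G c ×
  ((i j : Fin k) → i ≢ j → HasCycle G (TwoClasses c i j))

HasArborealColoring : ∀ {n} → Graph n → ℕ → Set
HasArborealColoring {n} G k = Σ (Fin n → Fin k) (IsArborealColoring G)

HasCompleteArborealColoring : ∀ {n} → Graph n → ℕ → Set
HasCompleteArborealColoring {n} G k = Σ (Fin n → Fin k) (IsCompleteArborealColoring G)

IsVertexArboricity : ∀ {n} → Graph n → ℕ → Set
IsVertexArboricity G k = HasArborealColoring G k × (∀ m → HasArborealColoring G m → k ≤ m)

IsAva : ∀ {n} → Graph n → ℕ → Set
IsAva G a = HasCompleteArborealColoring G a × (∀ m → HasCompleteArborealColoring G m → m ≤ a)

module Submission where

-- Both parts are one argument about an abstract predicate "S contains a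
-- cycle" on vertex sets that is monotone, holds only for nonempty sets and is
-- decidable (module ColouringSpectrum).  Fix a complete k-colouring c, an
-- acyclic χ-colouring and χ ≤ ℓ ≤ k.  Walking through the vertices
-- v₀, v₁, …, we maintain an acyclic ℓ-colouring that is constant on each
-- c-class as far as the first t vertices are concerned.  If no such colouring
-- exists with ℓ - 1 colours, ours is complete: an unused colour could be
-- deleted, and two colours spanning no cycle could be merged.  Otherwise we
-- take the (ℓ - 1)-colouring and give the already visited part of the c-class
-- of v_t a fresh colour, which absorbs v_t.  At t = n this would coarsen c to
-- fewer than k colours, merging two c-classes whose union has a cycle, so the
-- walk stops at a complete ℓ-colouring.  The converse direction is just the
-- definition of minimum and maximum.

open import Defs
open import Data.Nat using (ℕ; _≤_)
open import Data.Product using (_×_)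
open import Function.Bundles using (_⇔_)

open import Data.Nat using (zero; suc; pred; _<_; _+_; z≤n; s≤s; _≤?_; _<?_)
open import Data.Nat.Properties using (+-suc; +-identityʳ; m≤n+m; <-irrefl; m<1+n⇒m<n∨m≡n)
open import Data.Fin as F using (Fin; toℕ; fromℕ<; inject≤; punchIn; punchOut; _≟_)
open import Data.Fin.Properties
  using (any?; all?; pigeonhole; injective⇒≤; toℕ-injective; toℕ-fromℕ<; toℕ<n;
         inject≤-injective; suc-injective; punchOut-cong; punchIn-punchOut)
open import Data.List using (List; []; _∷_; _++_; length; lookup)
open import Data.List.Membership.Propositional.Properties using (∈-lookup)
open import Data.List.Relation.Unary.All as All using (All; _∷_)
open import Data.List.Relation.Unary.AllPairs using (_∷_)
open import Data.List.Relation.Unary.Unique.Propositional using (Unique)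
import Data.List.Relation.Unary.Unique.DecPropositional as UniqueDec
open import Data.Vec as V using (Vec; tabulate)
open import Data.Vec.Properties using (lookup∘tabulate)
open import Data.Product using (Σ; ∃; _,_; proj₁; proj₂)
open import Data.Sum using (_⊎_; inj₁; inj₂)
open import Data.Empty using (⊥; ⊥-elim)
open import Relation.Nullary using (¬_; Dec; yes; no)
open import Relation.Nullary.Decidable using (map′; _×-dec_; _⊎-dec_; _→-dec_; ¬?)
open import Relation.Binary.PropositionalEquality using (_≡_; _≢_; refl; sym; trans; cong; subst)
open import Function.Bundles using (mk⇔)

∃vec? : ∀ {m} L (P : Vec (Fin m) L → Set) → (∀ xs → Dec (P xs)) → Dec (∃ P)
∃vec? zero P P? = map′ (V.[] ,_) (λ { (V.[] , p) → p }) (P? V.[])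
∃vec? (suc L) P P? =
  map′ (λ (x , xs , p) → x V.∷ xs , p) (λ { (x V.∷ xs , p) → x , xs , p })
       (any? λ x → ∃vec? L (λ xs → P (x V.∷ xs)) (λ xs → P? (x V.∷ xs)))

-- The same for maps Fin n → Fin m (e.g. colourings), provided the property
-- respects pointwise equality, as we have no function extensionality.
∃function? : ∀ {n m} (P : (Fin n → Fin m) → Set) →
             (∀ {f g} → (∀ v → f v ≡ g v) → P f → P g) →
             (∀ f → Dec (P f)) → Dec (∃ P)
∃function? {n} P respects P? =
  map′ (λ (xs , p) → V.lookup xs , p)
       (λ (f , p) → tabulate f , respects (λ v → sym (lookup∘tabulate f v)) p)
       (∃vec? n (λ xs → P (V.lookup xs)) (λ xs → P? (V.lookup xs)))

∃listOfLength? : ∀ {m} L (P : List (Fin m) → Set) → (∀ l → Dec (P l)) →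
                 Dec (∃ λ l → length l ≡ L × P l)
∃listOfLength? zero P P? =
  map′ (λ p → [] , refl , p) (λ { ([] , _ , p) → p }) (P? [])
∃listOfLength? (suc L) P P? =
  map′ (λ (x , xs , len , p) → x ∷ xs , cong suc len , p)
       (λ { (x ∷ xs , len , p) → x , xs , cong pred len , p })
       (any? λ x → ∃listOfLength? L (λ xs → P (x ∷ xs)) (λ xs → P? (x ∷ xs)))

∃shortList? : ∀ {m} N (P : List (Fin m) → Set) → (∀ l → Dec (P l)) →
              (∀ {l} → P l → length l ≤ N) → Dec (∃ P)
∃shortList? N P P? short =
  map′ (λ (_ , l , _ , p) → l , p)
       (λ (l , p) → fromℕ< (s≤s (short p)) , l , sym (toℕ-fromℕ< (s≤s (short p))) , p)
       (any? {n = suc N} λ i → ∃listOfLength? (toℕ i) P P?)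

lookup-injective : ∀ {A : Set} {xs : List A} → Unique xs →
                   ∀ {i j} → lookup xs i ≡ lookup xs j → i ≡ j
lookup-injective (_ ∷ _) {F.zero} {F.zero} _ = refl
lookup-injective (x∉xs ∷ _) {F.zero} {F.suc j} e = ⊥-elim (All.lookup x∉xs (∈-lookup j) e)
lookup-injective (x∉xs ∷ _) {F.suc i} {F.zero} e = ⊥-elim (All.lookup x∉xs (∈-lookup i) (sym e))
lookup-injective (_ ∷ unique) {F.suc i} {F.suc j} e = cong F.suc (lookup-injective unique e)

unique⇒length≤ : ∀ {n} {l : List (Fin n)} → Unique l → length l ≤ n
unique⇒length≤ unique = injective⇒≤ (lookup-injective unique)

∃cycle? : ∀ {n} (Q : Fin n → List (Fin n) → Set) → (∀ v ws → Dec (Q v ws)) →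
          (∀ {v ws} → Q v ws → Unique (v ∷ ws)) →
          Dec (Σ (Fin n) λ v → Σ (List (Fin n)) (Q v))
∃cycle? {n} Q Q? unique =
  map′ (λ { ([] , ()) ; (v ∷ ws , q) → v , ws , q }) (λ (v , ws , q) → v ∷ ws , q)
       (∃shortList? n P P? (λ {l} → short l))
  where
  P : List (Fin n) → Set
  P [] = ⊥
  P (v ∷ ws) = Q v ws
  P? : ∀ l → Dec (P l)
  P? [] = no λ ()
  P? (v ∷ ws) = Q? v ws
  short : ∀ l → P l → length l ≤ n
  short (v ∷ ws) q = unique⇒length≤ (unique q)

chain? : ∀ {A : Set} {R : A → A → Set} → (∀ x y → Dec (R x y)) → ∀ xs → Dec (Chain R xs)
chain? R? [] = yes []
chain? R? (x ∷ []) = yes [-]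
chain? R? (x ∷ y ∷ xs) =
  map′ (λ (r , rs) → r ∷ rs) (λ { (r ∷ rs) → r , rs }) (R? x y ×-dec chain? R? (y ∷ xs))

module ColouringSpectrum {n : ℕ} (Cyclic : Subset n → Set)
  (cycle-mono : ∀ {S T : Subset n} → (∀ v → S v → T v) → Cyclic S → Cyclic T)
  (cycle-inhabited : ∀ {S} → Cyclic S → ∃ S)
  (cycle? : (S : Subset n) → (∀ v → Dec (S v)) → Dec (Cyclic S)) where

  ClassesAcyclic : ∀ {m} → (Fin n → Fin m) → Set
  ClassesAcyclic {m} f = (i : Fin m) → ¬ Cyclic (ColourClass f i)

  IsComplete : ∀ {m} → (Fin n → Fin m) → Set
  IsComplete {m} f =
    (IsOnto f × ClassesAcyclic f) × ((i j : Fin m) → i ≢ j → Cyclic (TwoClasses f i j))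

  HasAcyclicColouring : ℕ → Set
  HasAcyclicColouring m = Σ (Fin n → Fin m) λ f → IsOnto f × ClassesAcyclic f

  HasCompleteColouring : ℕ → Set
  HasCompleteColouring m = Σ (Fin n → Fin m) IsComplete

  -- Renaming the colours injectively keeps every class cycle-free.  (An
  -- empty class is trivially fine, which is where we need cycles to be
  -- inhabited.)
  rename-acyclic : ∀ {m m'} {f : Fin n → Fin m} (g : Fin m → Fin m') →
                   (∀ {a b} → g a ≡ g b → a ≡ b) →
                   ClassesAcyclic f → ClassesAcyclic (λ v → g (f v))
  rename-acyclic {f = f} g g-injective acyclic a cyc with cycle-inhabited cyc
  ... | w , gfw≡a = acyclic (f w) (cycle-mono (λ v gfv≡a → g-injective (trans gfv≡a (sym gfw≡a))) cyc)

  squeeze : ∀ {m} (f : Fin n → Fin (suc m)) (i : Fin (suc m)) → (∀ v → f v ≢ i) → Fin n → Fin m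
  squeeze f i unused v = punchOut (λ i≡fv → unused v (sym i≡fv))

  squeeze-acyclic : ∀ {m} {f : Fin n → Fin (suc m)} {i} (unused : ∀ v → f v ≢ i) →
                    ClassesAcyclic f → ClassesAcyclic (squeeze f i unused)
  squeeze-acyclic {i = i} unused acyclic a cyc =
    acyclic (punchIn i a) (cycle-mono (λ v e → trans (sym (punchIn-punchOut _)) (cong (punchIn i) e)) cyc)

  merge : ∀ {m} → Fin m → Fin m → Fin m → Fin m
  merge j i a with a ≟ j
  ... | yes _ = i
  ... | no _ = a

  merge-spec : ∀ {m} {j i a b : Fin m} → merge j i a ≡ b → (a ≡ j × i ≡ b) ⊎ (a ≢ j × a ≡ b)
  merge-spec {j = j} {a = a} e with a ≟ j
  ... | yes a≡j = inj₁ (a≡j , e)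
  ... | no a≢j = inj₂ (a≢j , e)

  merge-avoids : ∀ {m} {j i : Fin m} → i ≢ j → ∀ a → merge j i a ≢ j
  merge-avoids i≢j a e with merge-spec {a = a} e
  ... | inj₁ (_ , i≡j) = i≢j i≡j
  ... | inj₂ (a≢j , a≡j) = a≢j a≡j

  merge-acyclic : ∀ {m} {f : Fin n → Fin m} {i j} → ¬ Cyclic (TwoClasses f i j) →
                  ClassesAcyclic f → ClassesAcyclic (λ v → merge j i (f v))
  merge-acyclic {f = f} {i} {j} noCycle acyclic a cyc with a ≟ i
  ... | yes refl = noCycle (cycle-mono into-ij cyc)
    where
    into-ij : ∀ v → merge j a (f v) ≡ a → TwoClasses f a j v
    into-ij v e with merge-spec e
    ... | inj₁ (fv≡j , _) = inj₂ fv≡j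
    ... | inj₂ (_ , fv≡a) = inj₁ fv≡a
  ... | no a≢i = acyclic a (cycle-mono into-a cyc)
    where
    into-a : ∀ v → merge j i (f v) ≡ a → f v ≡ a
    into-a v e with merge-spec e
    ... | inj₁ (_ , i≡a) = ⊥-elim (a≢i (sym i≡a))
    ... | inj₂ (_ , fv≡a) = fv≡a

  isolate : ∀ {m} {X : Subset n} → (∀ v → Dec (X v)) → (Fin n → Fin m) → Fin n → Fin (suc m)
  isolate X? f v with X? v
  ... | yes _ = F.zero
  ... | no _ = F.suc (f v)

  isolate-spec : ∀ {m} {X : Subset n} (X? : ∀ v → Dec (X v)) (f : Fin n → Fin m) v →
                 (X v × isolate X? f v ≡ F.zero) ⊎ (¬ X v × isolate X? f v ≡ F.suc (f v))
  isolate-spec X? f v with X? v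
  ... | yes x = inj₁ (x , refl)
  ... | no ¬x = inj₂ (¬x , refl)

  isolate-inside : ∀ {m} {X : Subset n} (X? : ∀ v → Dec (X v)) (f : Fin n → Fin m) {v} →
                   X v → isolate X? f v ≡ F.zero
  isolate-inside X? f {v} x with isolate-spec X? f v
  ... | inj₁ (_ , e) = e
  ... | inj₂ (¬x , _) = ⊥-elim (¬x x)

  isolate-outside : ∀ {m} {X : Subset n} (X? : ∀ v → Dec (X v)) (f : Fin n → Fin m) {v} →
                    ¬ X v → isolate X? f v ≡ F.suc (f v)
  isolate-outside X? f {v} ¬x with isolate-spec X? f v
  ... | inj₁ (x , _) = ⊥-elim (¬x x)
  ... | inj₂ (_ , e) = e

  isolate-acyclic : ∀ {m} {X : Subset n} (X? : ∀ v → Dec (X v)) {f : Fin n → Fin m} →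
                    ¬ Cyclic X → ClassesAcyclic f → ClassesAcyclic (isolate X? f)
  isolate-acyclic {X = X} X? {f} noCycle acyclic F.zero cyc = noCycle (cycle-mono inside cyc)
    where
    inside : ∀ v → isolate X? f v ≡ F.zero → X v
    inside v e with isolate-spec X? f v
    ... | inj₁ (x , _) = x
    ... | inj₂ (_ , e′) with trans (sym e) e′
    ... | ()
  isolate-acyclic X? {f} noCycle acyclic (F.suc b) cyc = acyclic b (cycle-mono outside cyc)
    where
    outside : ∀ v → isolate X? f v ≡ F.suc b → f v ≡ b
    outside v e with isolate-spec X? f v
    ... | inj₂ (_ , e′) = suc-injective (trans (sym e′) e)
    ... | inj₁ (_ , e′) with trans (sym e) e′
    ... | ()

  module Walk {k} (c : Fin n → Fin k) (c-complete : IsComplete c) where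

    rep : Fin k → Fin n
    rep i = proj₁ (proj₁ (proj₁ c-complete) i)

    rep-colour : ∀ i → c (rep i) ≡ i
    rep-colour i = proj₂ (proj₁ (proj₁ c-complete) i)

    CoarsensBelow : ∀ {m} → ℕ → (Fin n → Fin m) → Set
    CoarsensBelow t f = ∀ u v → toℕ u < t → toℕ v < t → c u ≡ c v → f u ≡ f v

    Good : ∀ {m} → ℕ → (Fin n → Fin m) → Set
    Good t f = ClassesAcyclic f × CoarsensBelow t f

    Feasible : ℕ → ℕ → Set
    Feasible t m = Σ (Fin n → Fin m) (Good t)

    feasible? : ∀ t m → Dec (Feasible t m)
    feasible? t m = ∃function? (Good t) respects good?
      where
      respects : ∀ {f g : Fin n → Fin m} → (∀ v → f v ≡ g v) → Good t f → Good t g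
      respects f≗g (acyclic , coarsens) =
        (λ i cyc → acyclic i (cycle-mono (λ v e → trans (f≗g v) e) cyc)) ,
        (λ u v p q r → trans (sym (f≗g u)) (trans (coarsens u v p q r) (f≗g v)))
      good? : ∀ f → Dec (Good t f)
      good? f =
        all? (λ i → ¬? (cycle? (ColourClass f i) (λ v → f v ≟ i))) ×-dec
        all? (λ u → all? λ v → (toℕ u <? t) →-dec ((toℕ v <? t) →-dec
                                 ((c u ≟ c v) →-dec (f u ≟ f v))))

    drop-unused : ∀ {t m} (f : Fin n → Fin (suc m)) {i} → Good t f → (∀ v → f v ≢ i) → Feasible t m
    drop-unused f {i} (acyclic , coarsens) unused =
      squeeze f i unused , squeeze-acyclic unused acyclic ,
      λ u v p q r → punchOut-cong i (coarsens u v p q r)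

    minimal⇒complete : ∀ {t ℓ} (f : Fin n → Fin (suc ℓ)) → Good t f → ¬ Feasible t ℓ → IsComplete f
    minimal⇒complete f (acyclic , coarsens) minimal = (onto , acyclic) , spans-cycle
      where
      onto : IsOnto f
      onto i with any? (λ v → f v ≟ i)
      ... | yes hit = hit
      ... | no miss = ⊥-elim (minimal (drop-unused f (acyclic , coarsens) λ v e → miss (v , e)))
      spans-cycle : ∀ i j → i ≢ j → Cyclic (TwoClasses f i j)
      spans-cycle i j i≢j with cycle? (TwoClasses f i j) (λ v → (f v ≟ i) ⊎-dec (f v ≟ j))
      ... | yes cyc = cyc
      ... | no noCycle = ⊥-elim (minimal (drop-unused (λ v → merge j i (f v)) merged (λ v → merge-avoids i≢j (f v))))
        where
        merged : Good _ (λ v → merge j i (f v))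
        merged = merge-acyclic noCycle acyclic , λ u v p q r → cong (merge j i) (coarsens u v p q r)

    extend : ∀ {t m} → t < n → Feasible t m → Feasible (suc t) (suc m)
    extend {t} t<n (f , acyclic , coarsens) = isolate X? f , isolate-acyclic X? X-acyclic acyclic , coarsens′
      where
      w : Fin n
      w = fromℕ< t<n
      X : Subset n
      X v = toℕ v < suc t × c v ≡ c w
      X? : ∀ v → Dec (X v)
      X? v = (toℕ v <? suc t) ×-dec (c v ≟ c w)
      X-acyclic : ¬ Cyclic X
      X-acyclic cyc = proj₂ (proj₁ c-complete) (c w) (cycle-mono (λ v → proj₂) cyc)
      earlier : ∀ {v} → toℕ v < suc t → c v ≢ c w → toℕ v < t
      earlier v<1+t cv≢cw with m<1+n⇒m<n∨m≡n v<1+t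
      ... | inj₁ v<t = v<t
      ... | inj₂ v≡t = ⊥-elim (cv≢cw (cong c (toℕ-injective (trans v≡t (sym (toℕ-fromℕ< t<n))))))
      coarsens′ : CoarsensBelow (suc t) (isolate X? f)
      coarsens′ u v u<1+t v<1+t cu≡cv = by-class (c u ≟ c w)
        where
        by-class : Dec (c u ≡ c w) → isolate X? f u ≡ isolate X? f v
        by-class (yes cu≡cw) =
          trans (isolate-inside X? f (u<1+t , cu≡cw))
                (sym (isolate-inside X? f (v<1+t , trans (sym cu≡cv) cu≡cw)))
        by-class (no cu≢cw) =
          trans (isolate-outside X? f (λ x → cu≢cw (proj₂ x)))
                (trans (cong F.suc (coarsens u v (earlier u<1+t cu≢cw) (earlier v<1+t cv≢cw) cu≡cv))
                       (sym (isolate-outside X? f (λ x → cv≢cw (proj₂ x)))))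
          where
          cv≢cw : c v ≢ c w
          cv≢cw cv≡cw = cu≢cw (trans cu≡cv cv≡cw)

    -- Once all vertices are visited, fewer than k colours are impossible: two
    -- c-classes would share a colour, but their union contains a cycle.
    no-full-coarsening : ∀ {m} → m < k → ¬ Feasible n m
    no-full-coarsening m<k (f , acyclic , coarsens) with pigeonhole m<k (λ i → f (rep i))
    ... | i , j , i<j , same =
      acyclic (f (rep i)) (cycle-mono into (proj₂ c-complete i j λ i≡j → <-irrefl (cong toℕ i≡j) i<j))
      where
      same-class : ∀ v {a} → c v ≡ a → f v ≡ f (rep a)
      same-class v cv≡a = coarsens v _ (toℕ<n v) (toℕ<n _) (trans cv≡a (sym (rep-colour _)))
      into : ∀ v → TwoClasses c i j v → f v ≡ f (rep i)
      into v (inj₁ cv≡i) = same-class v cv≡i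
      into v (inj₂ cv≡j) = trans (same-class v cv≡j) (sym same)

    walk : ∀ {ℓ} → ℓ < k → ∀ d t → d + t ≡ n → Feasible t (suc ℓ) → HasCompleteColouring (suc ℓ)
    walk {ℓ} ℓ<k d t d+t≡n (f , good) with feasible? t ℓ
    ... | no minimal = f , minimal⇒complete f good minimal
    walk ℓ<k zero t refl _ | yes fewer = ⊥-elim (no-full-coarsening ℓ<k fewer)
    walk ℓ<k (suc d) t d+t≡n _ | yes fewer =
      walk ℓ<k d (suc t) (trans (+-suc d t) d+t≡n) (extend t<n fewer)
      where
      t<n : t < n
      t<n = subst (t <_) d+t≡n (s≤s (m≤n+m t d))

  interpolate : ∀ {χ k ℓ} → HasAcyclicColouring χ → HasCompleteColouring k →
                χ ≤ ℓ → ℓ ≤ k → HasCompleteColouring ℓ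
  -- (With ℓ = 0 also χ = 0, so n = 0 and the empty colouring is complete.)
  interpolate {ℓ = zero} (f₀ , _) _ z≤n _ = f₀ , ((λ ()) , (λ ())) , (λ ())
  interpolate {χ} {ℓ = suc ℓ} (f₀ , _ , acyclic₀) (c , c-complete) χ≤ℓ ℓ<k =
    walk ℓ<k n 0 (+-identityʳ n) (widened , rename-acyclic widen widen-injective acyclic₀ , λ _ _ ())
    where
    open Walk c c-complete
    -- the χ-colouring read as a (suc ℓ)-colouring; it coarsens c on no vertices yet
    widen : Fin χ → Fin (suc ℓ)
    widen a = inject≤ a χ≤ℓ
    widen-injective : ∀ {a b} → widen a ≡ widen b → a ≡ b
    widen-injective = inject≤-injective χ≤ℓ χ≤ℓ _ _
    widened : Fin n → Fin (suc ℓ)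
    widened v = widen (f₀ v)

  spectrum : ∀ ℓ {χ a} →
             HasAcyclicColouring χ × (∀ m → HasAcyclicColouring m → χ ≤ m) →
             HasCompleteColouring a × (∀ m → HasCompleteColouring m → m ≤ a) →
             HasCompleteColouring ℓ ⇔ (χ ≤ ℓ × ℓ ≤ a)
  spectrum ℓ (χ-colouring , χ-minimum) (a-colouring , a-maximum) =
    mk⇔ (λ (f , complete) → χ-minimum ℓ (f , proj₁ complete) , a-maximum ℓ (f , complete))
        (λ (χ≤ℓ , ℓ≤a) → interpolate χ-colouring a-colouring χ≤ℓ ℓ≤a)

module DirectedCycles {n} (D : Digraph n) where
  dicycle-mono : ∀ {S T : Subset n} → (∀ v → S v → T v) → HasDirCycle D S → HasDirCycle D T
  dicycle-mono S⊆T (v , ws , unique , inS , chain) = v , ws , unique , All.map (S⊆T _) inS , chain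

  dicycle-inhabited : ∀ {S} → HasDirCycle D S → ∃ S
  dicycle-inhabited (v , _ , _ , v∈S ∷ _ , _) = v , v∈S

  dicycle? : (S : Subset n) → (∀ v → Dec (S v)) → Dec (HasDirCycle D S)
  dicycle? S S? = ∃cycle? _ (λ v ws → unique? (v ∷ ws) ×-dec All.all? S? (v ∷ ws) ×-dec
                                       chain? (λ x y → 1 ≤? arcs D x y) _) proj₁
    where open UniqueDec (_≟_ {n})

module UndirectedCycles {n} (G : Graph n) where
  cycle-mono : ∀ {S T : Subset n} → (∀ v → S v → T v) → HasCycle G S → HasCycle G T
  cycle-mono S⊆T (inj₁ (u , v , u∈S , v∈S , bigon)) = inj₁ (u , v , S⊆T u u∈S , S⊆T v v∈S , bigon)
  cycle-mono S⊆T (inj₂ (v , ws , long , unique , inS , chain)) =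
    inj₂ (v , ws , long , unique , All.map (S⊆T _) inS , chain)

  cycle-inhabited : ∀ {S} → HasCycle G S → ∃ S
  cycle-inhabited (inj₁ (u , _ , u∈S , _)) = u , u∈S
  cycle-inhabited (inj₂ (v , _ , _ , _ , v∈S ∷ _ , _)) = v , v∈S

  cycle? : (S : Subset n) → (∀ v → Dec (S v)) → Dec (HasCycle G S)
  cycle? S S? = bigon? ⊎-dec longCycle?
    where
    open UniqueDec (_≟_ {n}) using (unique?)
    bigon? : Dec (Σ (Fin n) λ u → Σ (Fin n) λ v → S u × S v × 2 ≤ edges G u v)
    bigon? = any? λ u → any? λ v → S? u ×-dec S? v ×-dec (2 ≤? edges G u v)
    longCycle? : Dec (Σ (Fin n) λ v → Σ (List (Fin n)) λ ws →
                   3 ≤ length (v ∷ ws) × Unique (v ∷ ws) × All S (v ∷ ws) ×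
                   Chain (Adj G) (v ∷ ws ++ v ∷ []))
    longCycle? = ∃cycle? _ (λ v ws → (3 ≤? length (v ∷ ws)) ×-dec unique? (v ∷ ws) ×-dec
                                     All.all? S? (v ∷ ws) ×-dec chain? (λ x y → 1 ≤? edges G x y) _)
                           (λ q → proj₁ (proj₂ q))

theorem2p7 : (∀ {n} (D : Digraph n) (ℓ χ adi : ℕ) →
    IsDichromaticNumber D χ → IsAdi D adi →
    (HasCompleteAcyclicColoring D ℓ ⇔ (χ ≤ ℓ × ℓ ≤ adi)))
    ×
    (∀ {n} (G : Graph n) (ℓ va ava : ℕ) →
    IsVertexArboricity G va → IsAva G ava →
    (HasCompleteArborealColoring G ℓ ⇔ (va ≤ ℓ × ℓ ≤ ava)))
theorem2p7 = acyclic-part , arboreal-part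
  where
  acyclic-part : ∀ {n} (D : Digraph n) (ℓ χ adi : ℕ) →
    IsDichromaticNumber D χ → IsAdi D adi →
    (HasCompleteAcyclicColoring D ℓ ⇔ (χ ≤ ℓ × ℓ ≤ adi))
  acyclic-part D ℓ _ _ = spectrum ℓ
    where
    open DirectedCycles D
    open ColouringSpectrum (HasDirCycle D) dicycle-mono dicycle-inhabited dicycle?
  arboreal-part : ∀ {n} (G : Graph n) (ℓ va ava : ℕ) →
    IsVertexArboricity G va → IsAva G ava →
    (HasCompleteArborealColoring G ℓ ⇔ (va ≤ ℓ × ℓ ≤ ava))
  arboreal-part G ℓ _ _ = spectrum ℓ
    where
    open UndirectedCycles G
    open ColouringSpectrum (HasCycle G) cycle-mono cycle-inhabited cycle?
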